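{- Let $n\ge 3$ and let $\mathcal E_n=\{\mathcal E_{n,h}: h\in\{0,1,\ldots,n\}\}$. Every ordering in $\mathcal E_n$ is essential, and no ordering in $\mathcal S_n\setminus\mathcal E_n$ is essential.
   Context: A matrix chain of length $n$ is a product $M_1 M_2 \cdots M_n$ where $M_i$ has size $k_{i-1}\times k_i$; an instance is a tuple $\boldsymbol k=(k_0,k_1,\ldots,k_n)$ of positive integers. $\mathcal S_n$ denotes the set of all (full) parenthesisations (called orderings) of $M_1\cdots M_n$. Each of the $n-1$ multiplications in an ordering multiplies $(M_{a+1}\cdots M_b)$ by $(M_{b+1}\cdots M_c)$ for some $0\le a<b<c\le n$ at cost $k_a k_b k_c$; the cost $T(\mathcal A,\boldsymbol k)$ of an ordering is the sum of the costs of its $n-1$ multiplications. For a proper subset $\mathcal Q\subsetneq \mathcal S_n$, the penalty of removing $\mathcal Q$ on instance $\boldsymbol k$ is $$P(\mathcal Q,\boldsymbol k)=\frac{\min_{\mathcal B\in\mathcal S_n\setminus\mathcal Q}T(\mathcal B,\boldsymbol k)}{\min_{\mathcal A\in\mathcal S_n}T(\mathcal A,\boldsymbol k)}-1.$$ An ordering $\mathcal A$ is essential if for every $r\in\mathbb R^+$ there exists an instance $\boldsymbol k$ with $P(\{\mathcal A\},\boldsymbol k)>r$. For $h\in\{0,1,\ldots,n\}$, $\mathcal E_{n,h}$ is the ordering $L_h R_h$, where $L_h=(M_1(M_2(\cdots(M_{h-1}M_h)\cdots)))$ is the right-to-left product of $M_1,\ldots,M_h$, $R_h=((\cdots(M_{h+1}M_{h+2})\cdots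 M_{n-1})M_n)$ is the left-to-right product of $M_{h+1},\ldots,M_n$, and an empty product ($h=0$ or $h=n$) is omitted.
   Formalization: In the definition of an essential ordering, the threshold r ranges over the positive rationals rather than $\mathbb R^+$. -}

module Defs where

open import Data.Nat using (ℕ; zero; suc; _+_; _*_; _∸_; _≤_; _<_)
open import Data.Nat.Properties using (+-suc; +-identityʳ; +-comm; m+[n∸m]≡n)
open import Data.Vec using (Vec; []; _∷_)
open import Data.Vec.Relation.Unary.All using (All)
open import Data.Product using (Σ; ∃; _×_; _,_)
open import Data.Unit using (⊤)
open import Relation.Binary.PropositionalEquality using (_≡_; _≢_; subst; cong; trans; sym)

-- Ord a c : the (full) parenthesisations of the sub-chain M_{a+1} ⋯ M_c.
-- The orderings S_n of M_1 ⋯ M_n are the elements of  Ord 0 n.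
data Ord : ℕ → ℕ → Set where
  leaf : ∀ {i} → Ord i (suc i)
  node : ∀ {a b c} → Ord a b → Ord b c → Ord a c

-- An instance k = (k_0,…,k_n) is a vector of length n+1; k-at reads entry i
-- (entries beyond the vector are never used by orderings in Ord 0 n).
k-at : ∀ {m} → Vec ℕ m → ℕ → ℕ
k-at []       _       = 0
k-at (x ∷ xs) zero    = x
k-at (x ∷ xs) (suc i) = k-at xs i

Instance : ℕ → Set
Instance n = Σ (Vec ℕ (suc n)) (All (λ x → 0 < x))

cost : ∀ {a c m} → Ord a c → Vec ℕ m → ℕ
cost leaf k = 0
cost (node {a} {b} {c} l r) k = cost l k + cost r k + k-at k a * k-at k b * k-at k c

IsMinCost : (n : ℕ) → (Ord 0 n → Set) → Vec ℕ (suc n) → ℕ → Set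
IsMinCost n P k m =
  (∃ λ (A : Ord 0 n) → P A × cost A k ≡ m) × (∀ (A : Ord 0 n) → P A → m ≤ cost A k)

-- Penalty of removing {A} on instance k exceeds p/q (p,q positive):
-- min_{B ≠ A} T(B,k) / min_B T(B,k) - 1 > p/q, cross-multiplied.
PenaltyExceeds : (n : ℕ) → Ord 0 n → Vec ℕ (suc n) → ℕ → ℕ → Set
PenaltyExceeds n A k p q =
  ∃ λ (mAll : ℕ) → ∃ λ (mOther : ℕ) →
    IsMinCost n (λ _ → ⊤) k mAll × IsMinCost n (λ B → B ≢ A) k mOther ×
    (q + p) * mAll < q * mOther

Essential : (n : ℕ) → Ord 0 n → Set
Essential n A = ∀ (p q : ℕ) → 0 < p → 0 < q →
  ∃ λ (k : Instance n) → PenaltyExceeds n A (Data.Product.proj₁ k) p q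

rcomb : (a d : ℕ) → Ord a (suc (d + a))
rcomb a zero = leaf
rcomb a (suc d) = subst (Ord a) (cong suc (+-suc d a)) (node leaf (rcomb (suc a) d))

lcomb : (a d : ℕ) → Ord a (suc (d + a))
lcomb a zero = leaf
lcomb a (suc d) = node (lcomb a d) leaf

E'-lemma : (d e : ℕ) → e + suc (d + 0) ≡ d + suc e
E'-lemma d e = trans (cong (λ x → e + suc x) (+-identityʳ d))
  (trans (+-suc e d) (trans (cong suc (+-comm e d)) (sym (+-suc d e))))

-- E' h m = L_h R_h for the chain of length h + m (h leaves in L_h, m in R_h);
-- an empty factor is omitted. Requires h + m ≥ 1.
E' : (h m : ℕ) → 0 < h + m → Ord 0 (h + m)
E' zero (suc e) _ = subst (Ord 0) (cong suc (+-identityʳ e)) (lcomb 0 e)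
E' (suc d) zero _ = rcomb 0 d
E' (suc d) (suc e) _ =
  subst (Ord 0) (cong suc (E'-lemma d e)) (node (rcomb 0 d) (lcomb (suc (d + 0)) e))

E : (n h : ℕ) → h ≤ n → 0 < n → Ord 0 n
E n h h≤n 0<n =
  subst (Ord 0) (m+[n∸m]≡n h≤n)
    (E' h (n ∸ h) (subst (0 <_) (sym (m+[n∸m]≡n h≤n)) 0<n))

-- Every multiplication of E_{n,h} involves the index h, and E_{n,h} is the only ordering
-- with this property. Hence the instance with k_h = 1 and all other k_j = N makes E_{n,h}
-- cost at most n·N², while every other ordering pays N³ for some multiplication avoiding h.
-- Conversely, let k_m be a smallest entry of k. Each multiplication of E_{n,m} is
-- (x, x+1, m), (m, y, y+1) or (0, m, n); every ordering multiplies the factor M_{x+1} with a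
-- neighbour and performs some multiplication (0, b, n), so it costs at least as much as any
-- single multiplication of E_{n,m}. Thus T(E_{n,m}) ≤ n·min T, and the penalty of removing
-- an ordering other than E_{n,m} never exceeds n − 1.
module Submission where

open import Defs
open import Data.Nat using (ℕ; zero; suc; _+_; _*_; _∸_; _≤_; _<_; z≤n; s≤s; _≟_; _<?_; >-nonZero)
open import Data.Nat.Properties
open import Data.Product using (_×_; ∃; _,_; proj₁; proj₂)
open import Data.Sum using (_⊎_; inj₁; inj₂; map)
open import Function using (_∘_)
open import Data.Unit using (⊤; tt)
open import Data.Empty using (⊥-elim)
open import Data.List using (List; []; _∷_; _++_; upTo; filter; concatMap; cartesianProductWith)
open import Data.List.Extrema.Nat using (argmin; argmin-all; f[argmin]≤f[xs])
open import Data.List.Membership.Propositional using (_∈_; lose)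
open import Data.List.Membership.Propositional.Properties
  using (∈-++⁺ˡ; ∈-++⁺ʳ; ∈-concatMap⁺; ∈-cartesianProductWith⁺; ∈-upTo⁺; ∈-upTo⁻; ∈-filter⁺; ∈-filter⁻)
open import Data.List.Relation.Unary.Any using (here)
import Data.List.Relation.Unary.All as List
open import Data.Vec using (Vec; []; _∷_)
open import Data.Vec.Relation.Unary.All using (All; []; _∷_)
open import Relation.Nullary using (¬_; Dec; yes; no; ¬?; contradiction)
open import Relation.Nullary.Decidable using (_⊎-dec_)
open import Relation.Unary using (Decidable)
open import Relation.Binary.PropositionalEquality

ord⇒< : ∀ {a c} → Ord a c → a < c
ord⇒< leaf       = n<1+n _
ord⇒< (node l r) = <-trans (ord⇒< l) (ord⇒< r)

size : ∀ {a c} → Ord a c → ℕ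
size leaf       = 0
size (node l r) = suc (size l + size r)

size-+ : ∀ {a c} (B : Ord a c) → size B + suc a ≡ c
size-+ leaf = refl
size-+ {a} {c} (node {b = b} l r) = begin
  suc (size l + size r) + suc a   ≡⟨ cong (λ t → suc t + suc a) (+-comm (size l) (size r)) ⟩
  suc (size r + size l + suc a)   ≡⟨ cong suc (+-assoc (size r) (size l) (suc a)) ⟩
  suc (size r + (size l + suc a)) ≡⟨ sym (+-suc (size r) _) ⟩
  size r + suc (size l + suc a)   ≡⟨ cong (λ t → size r + suc t) (size-+ l) ⟩
  size r + suc b                  ≡⟨ size-+ r ⟩
  c                               ∎
  where open ≡-Reasoning

size≤ : ∀ {n} (B : Ord 0 n) → size B ≤ n
size≤ {n} B = subst (size B ≤_) (size-+ B) (m≤m+n (size B) 1)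

-- The multiplication of (M_{x+1}⋯M_y) by (M_{y+1}⋯M_z) is identified with the triple (x, y, z).

Pred₃ : Set₁
Pred₃ = ℕ → ℕ → ℕ → Set

AllMul : Pred₃ → ∀ {a c} → Ord a c → Set
AllMul P leaf                   = ⊤
AllMul P (node {a} {b} {c} l r) = P a b c × AllMul P l × AllMul P r

data AnyMul (P : Pred₃) : ∀ {a c} → Ord a c → Set where
  root  : ∀ {a b c} {l : Ord a b} {r : Ord b c} → P a b c → AnyMul P (node l r)
  left  : ∀ {a b c} {l : Ord a b} {r : Ord b c} → AnyMul P l → AnyMul P (node l r)
  right : ∀ {a b c} {l : Ord a b} {r : Ord b c} → AnyMul P r → AnyMul P (node l r)

module _ {P Q : Pred₃} where

  allMul-map : (∀ {x y z} → P x y z → Q x y z) → ∀ {a c} (B : Ord a c) → AllMul P B → AllMul Q B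
  allMul-map f leaf       _              = tt
  allMul-map f (node l r) (p , pl , pr) = f p , allMul-map f l pl , allMul-map f r pr

  allMul-zip : ∀ {a c} (B : Ord a c) → AllMul P B → AllMul Q B → AllMul (λ x y z → P x y z × Q x y z) B
  allMul-zip leaf       _              _              = tt
  allMul-zip (node l r) (p , pl , pr) (q , ql , qr) = (p , q) , allMul-zip l pl ql , allMul-zip r pr qr

  anyMul-map : (∀ {x y z} → P x y z → Q x y z) → ∀ {a c} {B : Ord a c} → AnyMul P B → AnyMul Q B
  anyMul-map f (root p)  = root (f p)
  anyMul-map f (left p)  = left (anyMul-map f p)
  anyMul-map f (right p) = right (anyMul-map f p)

  anyMul-allMul : ∀ {a c} {B : Ord a c} → AnyMul P B → AllMul Q B → AnyMul (λ x y z → P x y z × Q x y z) B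
  anyMul-allMul (root p)  (q , _ , _)  = root (p , q)
  anyMul-allMul (left p)  (_ , ql , _) = left (anyMul-allMul p ql)
  anyMul-allMul (right p) (_ , _ , qr) = right (anyMul-allMul p qr)

allMul⊎anyMul¬ : ∀ {P : Pred₃} → (∀ x y z → Dec (P x y z)) →
                 ∀ {a c} (B : Ord a c) → AllMul P B ⊎ AnyMul (λ x y z → ¬ P x y z) B
allMul⊎anyMul¬ P? leaf = inj₁ tt
allMul⊎anyMul¬ P? (node {a} {b} {c} l r) with P? a b c | allMul⊎anyMul¬ P? l | allMul⊎anyMul¬ P? r
... | no ¬p | _       | _       = inj₂ (root ¬p)
... | yes _ | inj₂ ¬l | _       = inj₂ (left ¬l)
... | yes _ | inj₁ _  | inj₂ ¬r = inj₂ (right ¬r)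
... | yes p | inj₁ pl | inj₁ pr = inj₁ (p , pl , pr)

Within : ℕ → ℕ → Pred₃
Within a c x y z = a ≤ x × x < y × y < z × z ≤ c

allMul-within : ∀ {a c} (B : Ord a c) → AllMul (Within a c) B
allMul-within leaf = tt
allMul-within (node l r) =
  (≤-refl , ord⇒< l , ord⇒< r , ≤-refl) ,
  allMul-map (λ (a≤x , x<y , y<z , z≤b) → a≤x , x<y , y<z , ≤-trans z≤b (<⇒≤ (ord⇒< r))) l (allMul-within l) ,
  allMul-map (λ (b≤x , x<y , y<z , z≤c) → ≤-trans (<⇒≤ (ord⇒< l)) b≤x , x<y , y<z , z≤c) r (allMul-within r)

rootless⇒single : ∀ {P : Pred₃} {a c} (B : Ord a c) → AllMul P B →
                  (∀ {b} → a < b → b < c → ¬ P a b c) → c ≡ suc a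
rootless⇒single leaf       _       _  = refl
rootless⇒single (node l r) (p , _) ¬P = ⊥-elim (¬P (ord⇒< l) (ord⇒< r) p)

weight : ∀ {m} → Vec ℕ m → ℕ → ℕ → ℕ → ℕ
weight k x y z = k-at k x * k-at k y * k-at k z

module _ {m} (k : Vec ℕ m) where

  cost≤size* : ∀ {X a c} (B : Ord a c) → AllMul (λ x y z → weight k x y z ≤ X) B → cost B k ≤ size B * X
  cost≤size* leaf _ = z≤n
  cost≤size* {X} (node l r) (p , pl , pr) = begin
    cost l k + cost r k + _          ≤⟨ +-mono-≤ (+-mono-≤ (cost≤size* l pl) (cost≤size* r pr)) p ⟩
    size l * X + size r * X + X      ≡⟨ +-comm _ X ⟩
    X + (size l * X + size r * X)    ≡⟨ cong (X +_) (sym (*-distribʳ-+ X (size l) (size r))) ⟩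
    suc (size l + size r) * X        ∎
    where open ≤-Reasoning

  anyMul⇒≤cost : ∀ {t a c} (B : Ord a c) → AnyMul (λ x y z → t ≤ weight k x y z) B → t ≤ cost B k
  anyMul⇒≤cost (node l r) (root p)  = ≤-trans p (m≤n+m _ _)
  anyMul⇒≤cost (node l r) (left p)  = ≤-trans (anyMul⇒≤cost l p) (≤-trans (m≤m+n _ _) (m≤m+n _ _))
  anyMul⇒≤cost (node l r) (right p) = ≤-trans (anyMul⇒≤cost r p) (≤-trans (m≤n+m _ (cost l k)) (m≤m+n _ _))

_≟ₒ_ : ∀ {a c} (A B : Ord a c) → Dec (A ≡ B)
leaf ≟ₒ leaf     = yes refl
leaf ≟ₒ node _ _ = no λ ()
node _ _ ≟ₒ leaf = no λ ()
node {b = b} l r ≟ₒ node {b = b′} l′ r′ with b ≟ b′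
... | no b≢b′ = no λ { refl → b≢b′ refl }
... | yes refl with l ≟ₒ l′ | r ≟ₒ r′
...   | yes refl | yes refl = yes refl
...   | no l≢l′  | _        = no λ { refl → l≢l′ refl }
...   | yes _    | no r≢r′  = no λ { refl → r≢r′ refl }

leaves : ∀ a c → List (Ord a c)
leaves a zero = []
leaves a (suc c) with a ≟ c
... | yes refl = leaf ∷ []
... | no _     = []

leaf∈leaves : ∀ a → leaf ∈ leaves a (suc a)
leaf∈leaves a with a ≟ a
... | yes refl = here refl
... | no a≢a   = contradiction refl a≢a

orderings : ℕ → ∀ a c → List (Ord a c)
orderings zero    a c = []
orderings (suc f) a c =
  leaves a c ++ concatMap (λ b → cartesianProductWith node (orderings f a b) (orderings f b c)) (upTo c)

∈-orderings : ∀ f {a c} (B : Ord a c) → size B < f → B ∈ orderings f a c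
∈-orderings (suc f) {a} leaf _ = ∈-++⁺ˡ (leaf∈leaves a)
∈-orderings (suc f) {a} {c} (node l r) (s≤s size<f) =
  ∈-++⁺ʳ (leaves a c) (∈-concatMap⁺ _ (lose (∈-upTo⁺ (ord⇒< r))
    (∈-cartesianProductWith⁺ node
      (∈-orderings f l (≤-trans (s≤s (m≤m+n _ _)) size<f))
      (∈-orderings f r (≤-trans (s≤s (m≤n+m _ _)) size<f)))))

minCost-exists : ∀ n (P : Ord 0 n → Set) → Decidable P → (k : Vec ℕ (suc n)) →
                 ∃ P → ∃ (IsMinCost n P k)
minCost-exists n P P? k (A , pA) = cost best k , (best , P-best , refl) , best-minimal
  where
  all-orderings candidates : List (Ord 0 n)
  all-orderings = orderings (suc n) 0 n
  candidates    = filter P? all-orderings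

  best : Ord 0 n
  best = argmin (λ B → cost B k) A candidates

  P-best : P best
  P-best = argmin-all (λ B → cost B k) pA (List.tabulate λ B∈ → proj₂ (∈-filter⁻ P? {xs = all-orderings} B∈))

  best-minimal : ∀ B → P B → cost best k ≤ cost B k
  best-minimal B pB = List.lookup (f[argmin]≤f[xs] {f = λ B → cost B k} A candidates)
    (∈-filter⁺ P? (∈-orderings (suc n) B (s≤s (size≤ B))) pB)

minimiser : (f : ℕ → ℕ) (n : ℕ) → ∃ λ m → m ≤ n × (∀ j → j ≤ n → f m ≤ f j)
minimiser f n = m , argmin-all f {xs = upTo (suc n)} z≤n (List.tabulate λ j∈ → ≤-pred (∈-upTo⁻ j∈)) ,
  λ j j≤n → List.lookup (f[argmin]≤f[xs] {f = f} 0 (upTo (suc n))) (∈-upTo⁺ (s≤s j≤n))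
  where m = argmin f 0 (upTo (suc n))

data EMul (h n x y z : ℕ) : Set where
  inL  : y ≡ suc x → z ≡ h → EMul h n x y z
  inR  : x ≡ h → z ≡ suc y → EMul h n x y z
  join : x ≡ 0 → y ≡ h → z ≡ n → EMul h n x y z

allMul-subst : ∀ {P : Pred₃} {a c c′} (e : c ≡ c′) (B : Ord a c) → AllMul P B → AllMul P (subst (Ord a) e B)
allMul-subst refl B p = p

rcomb-muls : ∀ {n} a d → AllMul (EMul (suc (d + a)) n) (rcomb a d)
rcomb-muls a zero = tt
rcomb-muls {n} a (suc d) = allMul-subst e (node leaf (rcomb (suc a) d))
  (inL refl e , tt , subst (λ h → AllMul (EMul h n) (rcomb (suc a) d)) e (rcomb-muls (suc a) d))
  where e = cong suc (+-suc d a)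

lcomb-muls : ∀ {n} a d → AllMul (EMul a n) (lcomb a d)
lcomb-muls a zero    = tt
lcomb-muls a (suc d) = inR refl refl , lcomb-muls a d , tt

E'-muls : ∀ h m (0<h+m : 0 < h + m) → AllMul (EMul h (h + m)) (E' h m 0<h+m)
E'-muls zero (suc e) _ = allMul-subst (cong suc (+-identityʳ e)) (lcomb 0 e) (lcomb-muls 0 e)
E'-muls (suc d) zero _ =
  subst (λ h → AllMul (EMul h (suc d + 0)) (rcomb 0 d)) (cong suc (+-identityʳ d)) (rcomb-muls 0 d)
E'-muls (suc d) (suc e) _ = allMul-subst (cong suc (E'-lemma d e)) (node (rcomb 0 d) (lcomb (suc (d + 0)) e))
  ( join refl h≡ (cong suc (E'-lemma d e))
  , subst (λ h → AllMul (EMul h n) (rcomb 0 d)) h≡ (rcomb-muls 0 d)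
  , subst (λ h → AllMul (EMul h n) (lcomb (suc (d + 0)) e)) h≡ (lcomb-muls (suc (d + 0)) e))
  where
  n = suc d + suc e
  h≡ = cong suc (+-identityʳ d)

E-muls : ∀ {n h} (h≤n : h ≤ n) (0<n : 0 < n) → AllMul (EMul h n) (E n h h≤n 0<n)
E-muls {n} {h} h≤n 0<n = allMul-subst h+[n∸h]≡n _
  (subst (λ t → AllMul (EMul h t) (E' h (n ∸ h) 0<h+[n∸h])) h+[n∸h]≡n (E'-muls h (n ∸ h) 0<h+[n∸h]))
  where
  h+[n∸h]≡n = m+[n∸m]≡n h≤n
  0<h+[n∸h] = subst (0 <_) (sym h+[n∸h]≡n) 0<n

Involves : ℕ → Pred₃
Involves h x y z = x ≡ h ⊎ y ≡ h ⊎ z ≡ h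

involves? : ∀ h x y z → Dec (Involves h x y z)
involves? h x y z = (x ≟ h) ⊎-dec ((y ≟ h) ⊎-dec (z ≟ h))

EMul⇒Involves : ∀ {h n x y z} → EMul h n x y z → Involves h x y z
EMul⇒Involves (inL _ z≡h)    = inj₂ (inj₂ z≡h)
EMul⇒Involves (inR x≡h _)    = inj₁ x≡h
EMul⇒Involves (join _ y≡h _) = inj₂ (inj₁ y≡h)

involves⇒between : ∀ {h x y z} → x < y → y < z → Involves h x y z → x ≤ h × h ≤ z
involves⇒between x<y y<z (inj₁ refl)        = ≤-refl , <⇒≤ (<-trans x<y y<z)
involves⇒between x<y y<z (inj₂ (inj₁ refl)) = <⇒≤ x<y , <⇒≤ y<z
involves⇒between x<y y<z (inj₂ (inj₂ refl)) = <⇒≤ (<-trans x<y y<z) , ≤-refl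

involving⇒single : ∀ {h a c} (B : Ord a c) → AllMul (Involves h) B → h < a ⊎ c < h → c ≡ suc a
involving⇒single B all outside =
  rootless⇒single B all λ a<b b<c inv → outside⇒¬between outside (involves⇒between a<b b<c inv)
  where
  outside⇒¬between : ∀ {h a c} → h < a ⊎ c < h → ¬ (a ≤ h × h ≤ c)
  outside⇒¬between (inj₁ h<a) (a≤h , _) = <⇒≱ h<a a≤h
  outside⇒¬between (inj₂ c<h) (_ , h≤c) = <⇒≱ c<h h≤c

-- The split point of an ordering all of whose multiplications involve h is determined:
-- it is h itself, unless h is an end point of the chain, in which case the factor away
-- from h is a single matrix.
involving-split : ∀ {h a b b′ c} (l : Ord a b) (r : Ord b c) (l′ : Ord a b′) (r′ : Ord b′ c) →
                  AllMul (Involves h) (node l r) → AllMul (Involves h) (node l′ r′) → b ≡ b′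
involving-split {h} {a} {b} {b′} {c} l r l′ r′ (ρ , α , β) (ρ′ , α′ , β′) = split ρ ρ′
  where
  right-factors-single : h ≤ a → b ≡ b′
  right-factors-single h≤a = suc-injective (trans
    (sym (involving⇒single r β (inj₁ (≤-<-trans h≤a (ord⇒< l)))))
    (involving⇒single r′ β′ (inj₁ (≤-<-trans h≤a (ord⇒< l′)))))

  left-factors-single : c ≤ h → b ≡ b′
  left-factors-single c≤h = trans
    (involving⇒single l α (inj₂ (<-≤-trans (ord⇒< r) c≤h)))
    (sym (involving⇒single l′ α′ (inj₂ (<-≤-trans (ord⇒< r′) c≤h))))

  split : Involves h a b c → Involves h a b′ c → b ≡ b′
  split (inj₁ a≡h)         _                  = right-factors-single (≤-reflexive (sym a≡h))
  split _                  (inj₁ a≡h)         = right-factors-single (≤-reflexive (sym a≡h))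
  split (inj₂ (inj₂ c≡h))  _                  = left-factors-single (≤-reflexive c≡h)
  split _                  (inj₂ (inj₂ c≡h))  = left-factors-single (≤-reflexive c≡h)
  split (inj₂ (inj₁ b≡h))  (inj₂ (inj₁ b′≡h)) = trans b≡h (sym b′≡h)

involving-unique : ∀ {h a c} (A B : Ord a c) → AllMul (Involves h) A → AllMul (Involves h) B → A ≡ B
involving-unique leaf leaf _ _ = refl
involving-unique leaf (node l r) _ _ = ⊥-elim (<⇒≱ (ord⇒< l) (≤-pred (ord⇒< r)))
involving-unique (node l r) leaf _ _ = ⊥-elim (<⇒≱ (ord⇒< l) (≤-pred (ord⇒< r)))
involving-unique (node l r) (node l′ r′) A-inv@(_ , α , β) B-inv@(_ , α′ , β′)
  with involving-split l r l′ r′ A-inv B-inv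
... | refl = cong₂ node (involving-unique l l′ α α′) (involving-unique r r′ β β′)

E-unique : ∀ {n h} (h≤n : h ≤ n) (0<n : 0 < n) (B : Ord 0 n) → AllMul (Involves h) B → B ≡ E n h h≤n 0<n
E-unique h≤n 0<n B B-inv =
  involving-unique B _ B-inv (allMul-map EMul⇒Involves _ (E-muls h≤n 0<n))

E-joins-differ : ∀ {n b} → 3 ≤ n → 0 < b → EMul 0 n 0 b n → ¬ EMul n n 0 b n
E-joins-differ ()                  _   (inL _ refl)    _
E-joins-differ _                   0<b (join _ refl _) _ = <-irrefl refl 0<b
E-joins-differ (s≤s (s≤s (s≤s _))) _   (inR _ refl)    (inL () _)
E-joins-differ _                   _   (inR _ refl)    (inR () _)
E-joins-differ _                   _   (inR _ refl)    (join _ () _)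

E0≢En : ∀ {n} (0<n : 0 < n) → 3 ≤ n → E n 0 z≤n 0<n ≢ E n n ≤-refl 0<n
E0≢En {n} 0<n 3≤n E0≡En = contradiction (subst (3 ≤_) n≡1 3≤n) λ { (s≤s ()) }
  where
  E0 = E n 0 z≤n 0<n
  n≡1 : n ≡ 1
  n≡1 = rootless⇒single E0
    (allMul-zip E0 (E-muls z≤n 0<n) (subst (AllMul (EMul n n)) (sym E0≡En) (E-muls ≤-refl 0<n)))
    λ 0<b _ (j₀ , jₙ) → E-joins-differ 3≤n 0<b j₀ jₙ

another-ordering : ∀ {n} (0<n : 0 < n) → 3 ≤ n → (A : Ord 0 n) → ∃ λ B → B ≢ A
another-ordering {n} 0<n 3≤n A with A ≟ₒ E n 0 z≤n 0<n
... | no A≢E0 = E n 0 z≤n 0<n , λ E0≡A → A≢E0 (sym E0≡A)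
... | yes refl = E n n ≤-refl 0<n , λ En≡E0 → E0≢En 0<n 3≤n (sym En≡E0)

vecOf : (ℕ → ℕ) → (len : ℕ) → Vec ℕ len
vecOf g zero      = []
vecOf g (suc len) = g 0 ∷ vecOf (λ i → g (suc i)) len

k-at-vecOf : ∀ g len {i} → i < len → k-at (vecOf g len) i ≡ g i
k-at-vecOf g (suc len) {zero}  _           = refl
k-at-vecOf g (suc len) {suc i} (s≤s i<len) = k-at-vecOf (λ j → g (suc j)) len i<len

vecOf-positive : ∀ {g} len → (∀ i → 0 < g i) → All (0 <_) (vecOf g len)
vecOf-positive zero      _     = []
vecOf-positive (suc len) g-pos = g-pos 0 ∷ vecOf-positive len (λ i → g-pos (suc i))

weight-vecOf : ∀ g n {x y z} → Within 0 n x y z → weight (vecOf g (suc n)) x y z ≡ g x * g y * g z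
weight-vecOf g n (_ , x<y , y<z , z≤n′) =
  cong₂ _*_ (cong₂ _*_ (k-at-vecOf g (suc n) (s≤s x≤n)) (k-at-vecOf g (suc n) (s≤s y≤n)))
            (k-at-vecOf g (suc n) (s≤s z≤n′))
  where
  y≤n = ≤-trans (<⇒≤ y<z) z≤n′
  x≤n = ≤-trans (<⇒≤ x<y) y≤n

product≤N*N : ∀ {a b c N} → a ≤ N → b ≤ N → c ≤ N → a ≡ 1 ⊎ b ≡ 1 ⊎ c ≡ 1 → a * b * c ≤ N * N
product≤N*N {b = b} _ b≤N c≤N (inj₁ refl) =
  *-mono-≤ (subst (_≤ _) (sym (*-identityˡ b)) b≤N) c≤N
product≤N*N {a = a} a≤N _ c≤N (inj₂ (inj₁ refl)) =
  *-mono-≤ (subst (_≤ _) (sym (*-identityʳ a)) a≤N) c≤N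
product≤N*N {a} {b} {N = N} a≤N b≤N _ (inj₂ (inj₂ refl)) =
  subst (_≤ N * N) (sym (*-identityʳ (a * b))) (*-mono-≤ a≤N b≤N)

spike : ℕ → ℕ → ℕ → ℕ
spike h N j with j ≟ h
... | yes _ = 1
... | no _  = N

module _ {h N : ℕ} where

  spike-at : spike h N h ≡ 1
  spike-at with h ≟ h
  ... | yes _  = refl
  ... | no h≢h = contradiction refl h≢h

  spike-off : ∀ {j} → j ≢ h → spike h N j ≡ N
  spike-off {j} j≢h with j ≟ h
  ... | yes j≡h = contradiction j≡h j≢h
  ... | no _    = refl

  spike≤ : 1 ≤ N → ∀ j → spike h N j ≤ N
  spike≤ 1≤N j with j ≟ h
  ... | yes _ = 1≤N
  ... | no _  = ≤-refl

  spike-positive : 0 < N → ∀ j → 0 < spike h N j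
  spike-positive 0<N j with j ≟ h
  ... | yes _ = s≤s z≤n
  ... | no _  = 0<N

  spike-involving : 1 ≤ N → ∀ {x y z} → Involves h x y z → spike h N x * spike h N y * spike h N z ≤ N * N
  spike-involving 1≤N {x} {y} {z} inv =
    product≤N*N (spike≤ 1≤N x) (spike≤ 1≤N y) (spike≤ 1≤N z) (map at (map at at) inv)
    where
    at : ∀ {j} → j ≡ h → spike h N j ≡ 1
    at refl = spike-at

  spike-avoiding : ∀ {x y z} → ¬ Involves h x y z → spike h N x * spike h N y * spike h N z ≡ N * N * N
  spike-avoiding ¬inv = cong₂ _*_ (cong₂ _*_ (spike-off (¬inv ∘ inj₁)) (spike-off (¬inv ∘ inj₂ ∘ inj₁)))
                                  (spike-off (¬inv ∘ inj₂ ∘ inj₂))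

module SpikeInstance (n h N : ℕ) where

  k : Vec ℕ (suc n)
  k = vecOf (spike h N) (suc n)

  cost-involving : 1 ≤ N → (B : Ord 0 n) → AllMul (Involves h) B → cost B k ≤ n * (N * N)
  cost-involving 1≤N B inv =
    ≤-trans (cost≤size* k B (allMul-map bound B (allMul-zip B inv (allMul-within B))))
            (*-monoˡ-≤ (N * N) (size≤ B))
    where
    bound : ∀ {x y z} → Involves h x y z × Within 0 n x y z → weight k x y z ≤ N * N
    bound (inv , within) =
      subst (_≤ N * N) (sym (weight-vecOf (spike h N) n within)) (spike-involving {h} {N} 1≤N inv)

  cost-avoiding : (B : Ord 0 n) → AnyMul (λ x y z → ¬ Involves h x y z) B → N * N * N ≤ cost B k
  cost-avoiding B avoid = anyMul⇒≤cost k B (anyMul-map bound (anyMul-allMul avoid (allMul-within B)))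
    where
    bound : ∀ {x y z} → ¬ Involves h x y z × Within 0 n x y z → N * N * N ≤ weight k x y z
    bound (¬inv , within) =
      ≤-reflexive (sym (trans (weight-vecOf (spike h N) n within) (spike-avoiding {h} {N} ¬inv)))

E-essential : ∀ {n h} (h≤n : h ≤ n) (0<n : 0 < n) → 3 ≤ n → Essential n (E n h h≤n 0<n)
E-essential {n} {h} h≤n 0<n 3≤n p q _ 0<q =
  (k , vecOf-positive (suc n) (spike-positive (s≤s z≤n))) ,
  cost Eₕ k , mOther , ((Eₕ , tt , refl) , λ B _ → Eₕ-cheapest B) , others-min , penalty
  where
  N = suc ((q + p) * n)
  open SpikeInstance n h N

  Eₕ : Ord 0 n
  Eₕ = E n h h≤n 0<n

  cost-Eₕ : cost Eₕ k ≤ n * (N * N)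
  cost-Eₕ = cost-involving (s≤s z≤n) Eₕ (allMul-map EMul⇒Involves Eₕ (E-muls h≤n 0<n))

  scaled-cost-Eₕ : (q + p) * cost Eₕ k < N * N * N
  scaled-cost-Eₕ = begin-strict
    (q + p) * cost Eₕ k     ≤⟨ *-monoʳ-≤ (q + p) cost-Eₕ ⟩
    (q + p) * (n * (N * N)) ≡⟨ sym (*-assoc (q + p) n (N * N)) ⟩
    (q + p) * n * (N * N)   <⟨ *-monoˡ-< (N * N) (n<1+n ((q + p) * n)) ⟩
    N * (N * N)             ≡⟨ sym (*-assoc N N N) ⟩
    N * N * N               ∎
    where open ≤-Reasoning

  others-cost : (B : Ord 0 n) → B ≢ Eₕ → N * N * N ≤ cost B k
  others-cost B B≢Eₕ with allMul⊎anyMul¬ (involves? h) B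
  ... | inj₁ inv   = contradiction (E-unique h≤n 0<n B inv) B≢Eₕ
  ... | inj₂ avoid = cost-avoiding B avoid

  Eₕ-cheapest : (B : Ord 0 n) → cost Eₕ k ≤ cost B k
  Eₕ-cheapest B with B ≟ₒ Eₕ
  ... | yes refl = ≤-refl
  ... | no B≢Eₕ  = begin
    cost Eₕ k           ≤⟨ m≤n*m (cost Eₕ k) (q + p) {{>-nonZero (≤-trans 0<q (m≤m+n q p))}} ⟩
    (q + p) * cost Eₕ k <⟨ scaled-cost-Eₕ ⟩
    N * N * N           ≤⟨ others-cost B B≢Eₕ ⟩
    cost B k            ∎
    where open ≤-Reasoning

  others : ∃ (IsMinCost n (_≢ Eₕ) k)
  others = minCost-exists n (_≢ Eₕ) (λ B → ¬? (B ≟ₒ Eₕ)) k (another-ordering 0<n 3≤n Eₕ)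

  mOther = proj₁ others
  others-min = proj₂ others

  N³≤mOther : N * N * N ≤ mOther
  N³≤mOther with proj₁ others-min
  ... | B , B≢Eₕ , cost-B≡mOther = subst (N * N * N ≤_) cost-B≡mOther (others-cost B B≢Eₕ)

  penalty : (q + p) * cost Eₕ k < q * mOther
  penalty = begin-strict
    (q + p) * cost Eₕ k <⟨ scaled-cost-Eₕ ⟩
    N * N * N           ≤⟨ m≤n*m (N * N * N) q {{>-nonZero 0<q}} ⟩
    q * (N * N * N)     ≤⟨ *-monoʳ-≤ q N³≤mOther ⟩
    q * mOther          ∎
    where open ≤-Reasoning

HasFactor : ℕ → Pred₃
HasFactor i x y z = (x ≡ i × y ≡ suc i) ⊎ (y ≡ i × z ≡ suc i)

factor-multiplied : ∀ {a c i} (B : Ord a c) → a ≤ i → i < c → c ≡ suc a ⊎ AnyMul (HasFactor i) B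
factor-multiplied leaf _ _ = inj₁ refl
factor-multiplied {i = i} (node {b = b} l r) a≤i i<c with i <? b
... | yes i<b with factor-multiplied l a≤i i<b
...   | inj₁ refl = inj₂ (root (inj₁ (a≡i , cong suc a≡i)))
  where a≡i = ≤-antisym a≤i (≤-pred i<b)
...   | inj₂ l-mul = inj₂ (left l-mul)
factor-multiplied {i = i} (node {b = b} l r) a≤i i<c | no i≮b with factor-multiplied r (≮⇒≥ i≮b) i<c
...   | inj₁ refl = inj₂ (root (inj₂ (b≡i , cong suc b≡i)))
  where b≡i = ≤-antisym (≮⇒≥ i≮b) (≤-pred i<c)
...   | inj₂ r-mul = inj₂ (right r-mul)

module LightestIndex (n : ℕ) (k : Vec ℕ (suc n)) (m : ℕ)
                     (m-lightest : ∀ j → j ≤ n → k-at k m ≤ k-at k j) where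

  K : ℕ → ℕ
  K = k-at k

  adjacent≤cost : ∀ {i} (B : Ord 0 n) → 1 < n → i < n → K i * K (suc i) * K m ≤ cost B k
  adjacent≤cost {i} B 1<n i<n with factor-multiplied B z≤n i<n
  ... | inj₁ refl = contradiction 1<n (<-irrefl refl)
  ... | inj₂ mul  = anyMul⇒≤cost k B (anyMul-map bound (anyMul-allMul mul (allMul-within B)))
    where
    bound : ∀ {x y z} → HasFactor i x y z × Within 0 n x y z → K i * K (suc i) * K m ≤ weight k x y z
    bound (inj₁ (refl , refl) , _ , _ , _ , z≤n′) = *-monoʳ-≤ (K i * K (suc i)) (m-lightest _ z≤n′)
    bound {x} (inj₂ (refl , refl) , _ , x<i , _ , _) = begin
      K i * K (suc i) * K m   ≤⟨ *-monoʳ-≤ (K i * K (suc i)) (m-lightest x (<⇒≤ (<-trans x<i i<n))) ⟩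
      K i * K (suc i) * K x   ≡⟨ *-comm (K i * K (suc i)) (K x) ⟩
      K x * (K i * K (suc i)) ≡⟨ sym (*-assoc (K x) (K i) (K (suc i))) ⟩
      K x * K i * K (suc i)   ∎
      where open ≤-Reasoning

  join≤cost : (B : Ord 0 n) → 1 < n → K 0 * K m * K n ≤ cost B k
  join≤cost leaf (s≤s ())
  join≤cost (node {b = b} l r) _ =
    ≤-trans (*-monoˡ-≤ (K n) (*-monoʳ-≤ (K 0) (m-lightest b (<⇒≤ (ord⇒< r))))) (m≤n+m _ _)

  EMul≤cost : ∀ {x y z} (B : Ord 0 n) → Within 0 n x y z → EMul m n x y z → weight k x y z ≤ cost B k
  EMul≤cost {x} B (_ , _ , x+1<m , m≤n) (inL refl refl) =
    adjacent≤cost B (≤-trans (s≤s (s≤s z≤n)) x+2≤n) (<-trans (n<1+n x) x+2≤n)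
    where x+2≤n = ≤-trans x+1<m m≤n
  EMul≤cost {y = y} B (_ , m<y , _ , y+1≤n) (inR refl refl) = begin
    K m * K y * K (suc y)   ≡⟨ *-assoc (K m) (K y) (K (suc y)) ⟩
    K m * (K y * K (suc y)) ≡⟨ *-comm (K m) (K y * K (suc y)) ⟩
    K y * K (suc y) * K m   ≤⟨ adjacent≤cost B (≤-trans (s≤s (≤-trans (s≤s z≤n) m<y)) y+1≤n) y+1≤n ⟩
    cost B k                ∎
    where open ≤-Reasoning
  EMul≤cost B (_ , 0<m , m<n , _) (join refl refl refl) = join≤cost B (≤-trans (s≤s 0<m) m<n)

non-E-inessential : ∀ {n} (0<n : 0 < n) (A : Ord 0 n) → (∀ h (h≤n : h ≤ n) → A ≢ E n h h≤n 0<n) →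
                    ¬ Essential n A
non-E-inessential {n} 0<n A A≢E essential with essential n 1 0<n (s≤s z≤n)
... | (k , _) , mAll , mOther , ((B , _ , cost-B≡mAll) , _) , (_ , mOther-minimal) , penalty =
  <⇒≱ penalty (begin
    1 * mOther          ≡⟨ *-identityˡ mOther ⟩
    mOther              ≤⟨ mOther-minimal Eₘ (λ Eₘ≡A → A≢E m m≤n (sym Eₘ≡A)) ⟩
    cost Eₘ k           ≤⟨ cost≤size* k Eₘ (allMul-map bound Eₘ Eₘ-muls) ⟩
    size Eₘ * cost B k  ≤⟨ *-mono-≤ (size≤ Eₘ) (≤-reflexive cost-B≡mAll) ⟩
    n * mAll            ≤⟨ m≤n+m (n * mAll) mAll ⟩
    (1 + n) * mAll      ∎)
  where
  open ≤-Reasoning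
  lightest = minimiser (k-at k) n
  m = proj₁ lightest
  m≤n = proj₁ (proj₂ lightest)
  open LightestIndex n k m (proj₂ (proj₂ lightest))
  Eₘ = E n m m≤n 0<n
  Eₘ-muls = allMul-zip Eₘ (allMul-within Eₘ) (E-muls m≤n 0<n)
  bound : ∀ {x y z} → Within 0 n x y z × EMul m n x y z → weight k x y z ≤ cost B k
  bound (within , emul) = EMul≤cost B within emul

theorem5p4 : (n : ℕ) → (n≥3 : 3 ≤ n) →
    ((h : ℕ) → (h≤n : h ≤ n) → Essential n (E n h h≤n (≤-trans (Data.Nat.s≤s Data.Nat.z≤n) n≥3)))
    × ((A : Ord 0 n) → ((h : ℕ) → (h≤n : h ≤ n) → A ≢ E n h h≤n (≤-trans (Data.Nat.s≤s Data.Nat.z≤n) n≥3)) → ¬ Essential n A)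
theorem5p4 n n≥3 = (λ h h≤n → E-essential h≤n 0<n n≥3) , non-E-inessential 0<n
  where 0<n = ≤-trans (s≤s z≤n) n≥3
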